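{- If $n$ is a positive odd integer and $y$ and $w$ are complex numbers with $w\neq0$, then \[ \sum_{k=0}^n(-1)^k\binom nk\left(\frac yw\right)^k B_{n-k}(y)B_k(w)=\frac{ny}{2w}\left(1-\left(\frac yw\right)^{n-2}\right)B_{n-1}. \]
   Context: The Bernoulli polynomials $B_k(x)$ are defined by $\frac{z e^{xz}}{e^z-1}=\sum_{k\ge0}B_k(x)\frac{z^k}{k!}$ ($|z|<2\pi$), and the Bernoulli numbers are $B_k=B_k(0)$. -}

module Defs where

open import Level using (Level; _⊔_) renaming (suc to lsuc)
open import Algebra.Bundles using (CommutativeRing)
open import Data.Nat using (ℕ; zero; suc; _∸_)
open import Data.Nat.Combinatorics using (_C_)
open import Data.List using (List; []; _∷_; length)
open import Relation.Nullary using (¬_)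

module NatCast {c ℓ} (R : CommutativeRing c ℓ) where
  open CommutativeRing R

  ι : ℕ → Carrier
  ι zero    = 0#
  ι (suc n) = 1# + ι n

-- A field of characteristic zero (ℂ is an instance).
record CharZeroField c ℓ : Set (lsuc (c ⊔ ℓ)) where
  field
    commRing : CommutativeRing c ℓ
  open CommutativeRing commRing public
  open NatCast commRing public
  field
    inv      : (x : Carrier) → ¬ (x ≈ 0#) → Carrier
    inverse  : ∀ x (p : ¬ (x ≈ 0#)) → x * inv x p ≈ 1#
    charZero : ∀ n → ¬ (ι (suc n) ≈ 0#)

module FieldOps {c ℓ} (F : CharZeroField c ℓ) where
  open CharZeroField F

  pow : Carrier → ℕ → Carrier
  pow x zero    = 1#
  pow x (suc k) = x * pow x k

  sumTo : ℕ → (ℕ → Carrier) → Carrier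
  sumTo zero    f = f 0
  sumTo (suc n) f = sumTo n f + f (suc n)

  recipSuc : ℕ → Carrier
  recipSuc m = inv (ι (suc m)) (charZero m)

  -- for the list [B_m, ..., B_0] (reversed), computes Σ_{j=0}^{m} C(N, j) B_j
  weighted : ℕ → List Carrier → Carrier
  weighted N []       = 0#
  weighted N (x ∷ xs) = ι (N C length xs) * x + weighted N xs

  -- Bernoulli numbers B_0, ..., B_m (reversed list), via the recurrence
  -- B_0 = 1,  Σ_{j=0}^{m} C(m+1, j) B_j = 0 for m ≥ 1
  -- (equivalent to z/(e^z - 1) = Σ B_k z^k / k!).
  bernRev : ℕ → List Carrier
  bernRev zero    = 1# ∷ []
  bernRev (suc m) =
    (- (recipSuc (suc m) * weighted (suc (suc m)) (bernRev m))) ∷ bernRev m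

  headOr0 : List Carrier → Carrier
  headOr0 []      = 0#
  headOr0 (x ∷ _) = x

  bernoulli : ℕ → Carrier
  bernoulli m = headOr0 (bernRev m)

  bernoulliPoly : ℕ → Carrier → Carrier
  bernoulliPoly n x = sumTo n (λ k → ι (n C k) * bernoulli k * pow x (n ∸ k))

{-# OPTIONS --safe #-}
{-
Encode an exponential generating function f(z) = Σ aₙ zⁿ/n! by its coefficient sequence a.
Products of series become binomial convolutions _⋆_, pow x encodes e^{xz}, and Bₙ(x) is the
n-th coefficient of B(z) e^{xz} with B(z) = z/(e^z − 1). For t = −y/w we have t w = −y, so the
left-hand side is the n-th coefficient of B(tz) e^{−yz} · B(z) e^{yz} = B(tz) B(z).

The defining recurrence says that B(z) is inverse to (e^z − 1)/z. Dilating by −1, both B(−z) and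
e^z B(z) = B(z) + z are inverse to (1 − e^{−z})/z, so B(z) + z/2 is even and B_k = 0 for odd
k ≥ 3. Hence for odd n the n-th coefficient of B(tz) B(z) only receives the terms involving
B₁ = −1/2, namely n B₁ B_{n−1} (t + t^{n−1}).
-}
module Submission where

open import Defs
open import Algebra.Bundles using (CommutativeRing)
open import Data.Fin using (Fin; toℕ)
open import Data.Nat using (ℕ; zero; suc; _∸_; _≤_; z≤n; s≤s; s≤s⁻¹; _!; NonZero; parity)
  renaming (_+_ to _+ℕ_; _*_ to _*ℕ_)
open import Data.Nat.Combinatorics
  using (_C_; nCk≡n!/k![n-k]!; k![n∸k]!∣n!; nCk≡nC[n∸k]; nC1≡n; nCn≡1)
open import Data.Nat.DivMod using (m/n*n≡m)
import Data.Nat.Properties as ℕ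
open import Data.Empty using (⊥-elim)
open import Data.List using (length)
open import Data.Product using (_,_)
open import Data.Parity using (0ℙ; 1ℙ)
open import Data.Sum using (_⊎_; inj₁; inj₂)
open import Relation.Nullary using (¬_)
open import Function using (_∘_)
open import Relation.Binary.PropositionalEquality using (_≡_; _≢_; cong; cong₂; module ≡-Reasoning)
import Relation.Binary.PropositionalEquality as ≡

module BinomialCoefficients where
  open ≡-Reasoning
  open import Data.Nat.Properties
    using (∸-+-assoc; m+n∸m≡n; m+n∸n≡m; n≤1+n; m≤m+n; m+n≤o⇒m≤o; m+n≤o⇒m≤o∸n; +-comm; *-cancelʳ-≡; m*n≢0; _!≢0; _!*_!≢0)
  open import Data.Nat.Solver using (module +-*-Solver)
  open +-*-Solver using (solve; _:*_; _:=_)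

  nCk*[k!*[n∸k]!]≡n! : ∀ {n k} → k ≤ n → (n C k) *ℕ (k ! *ℕ (n ∸ k) !) ≡ n !
  nCk*[k!*[n∸k]!]≡n! {n} {k} k≤n =
    ≡.trans (cong (_*ℕ (k ! *ℕ (n ∸ k) !)) (nCk≡n!/k![n-k]! k≤n))
            (m/n*n≡m {{k !* (n ∸ k) !≢0}} (k![n∸k]!∣n! k≤n))

  [1+n]Cn≡1+n : ∀ n → suc n C n ≡ suc n
  [1+n]Cn≡1+n n = ≡.trans (nCk≡nC[n∸k] (n≤1+n n)) (≡.trans (cong (suc n C_) (m+n∸n≡m 1 n)) (nC1≡n (suc n)))

  nC[i+j]*[i+j]Ci≡nCi*[n∸i]Cj : ∀ {n} i j → i +ℕ j ≤ n →
                                (n C (i +ℕ j)) *ℕ ((i +ℕ j) C i) ≡ (n C i) *ℕ ((n ∸ i) C j)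
  nC[i+j]*[i+j]Ci≡nCi*[n∸i]Cj {n} i j i+j≤n =
    *-cancelʳ-≡ _ _ (i ! *ℕ (j ! *ℕ r !)) {{nonZero}} (≡.trans viaLeft (≡.sym viaRight))
    where
    r : ℕ
    r = n ∸ i ∸ j
    nonZero : NonZero (i ! *ℕ (j ! *ℕ r !))
    nonZero = m*n≢0 _ _ {{i !≢0}} {{j !* r !≢0}}
    r≡ : r ≡ n ∸ (i +ℕ j)
    r≡ = ∸-+-assoc n i j
    viaLeft : (n C (i +ℕ j)) *ℕ ((i +ℕ j) C i) *ℕ (i ! *ℕ (j ! *ℕ r !)) ≡ n !
    viaLeft = begin
      (n C (i +ℕ j)) *ℕ ((i +ℕ j) C i) *ℕ (i ! *ℕ (j ! *ℕ r !))
        ≡⟨ solve 5 (λ a b x y z → a :* b :* (x :* (y :* z)) := a :* (b :* (x :* y) :* z)) ≡.refl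
             (n C (i +ℕ j)) ((i +ℕ j) C i) (i !) (j !) (r !) ⟩
      (n C (i +ℕ j)) *ℕ (((i +ℕ j) C i) *ℕ (i ! *ℕ j !) *ℕ r !)
        ≡⟨ cong (λ s → (n C (i +ℕ j)) *ℕ (((i +ℕ j) C i) *ℕ (i ! *ℕ s !) *ℕ r !)) (≡.sym (m+n∸m≡n i j)) ⟩
      (n C (i +ℕ j)) *ℕ (((i +ℕ j) C i) *ℕ (i ! *ℕ ((i +ℕ j) ∸ i) !) *ℕ r !)
        ≡⟨ cong₂ (λ s t → (n C (i +ℕ j)) *ℕ (s *ℕ t !)) (nCk*[k!*[n∸k]!]≡n! (m≤m+n i j)) r≡ ⟩
      (n C (i +ℕ j)) *ℕ ((i +ℕ j) ! *ℕ (n ∸ (i +ℕ j)) !)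
        ≡⟨ nCk*[k!*[n∸k]!]≡n! i+j≤n ⟩
      n ! ∎
    viaRight : (n C i) *ℕ ((n ∸ i) C j) *ℕ (i ! *ℕ (j ! *ℕ r !)) ≡ n !
    viaRight = begin
      (n C i) *ℕ ((n ∸ i) C j) *ℕ (i ! *ℕ (j ! *ℕ r !))
        ≡⟨ solve 5 (λ a b x y z → a :* b :* (x :* (y :* z)) := a :* (x :* (b :* (y :* z)))) ≡.refl
             (n C i) ((n ∸ i) C j) (i !) (j !) (r !) ⟩
      (n C i) *ℕ (i ! *ℕ (((n ∸ i) C j) *ℕ (j ! *ℕ r !)))
        ≡⟨ cong (λ s → (n C i) *ℕ (i ! *ℕ s)) (nCk*[k!*[n∸k]!]≡n! (m+n≤o⇒m≤o∸n j (≡.subst (_≤ n) (+-comm i j) i+j≤n))) ⟩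
      (n C i) *ℕ (i ! *ℕ (n ∸ i) !)
        ≡⟨ nCk*[k!*[n∸k]!]≡n! (m+n≤o⇒m≤o i i+j≤n) ⟩
      n ! ∎

module Parity where
  open import Data.Parity.Base as ℙ using ()
  open import Data.Parity.Properties using (+-homo-+; *-homo-*)

  parity[1+2m]≡1ℙ : ∀ m → parity (suc (2 *ℕ m)) ≡ 1ℙ
  parity[1+2m]≡1ℙ m = ≡.trans (+-homo-+ 1 (2 *ℕ m)) (cong (1ℙ ℙ.+_) (*-homo-* 2 m))

  parity[2m]≡0ℙ : ∀ m → parity (2 *ℕ m) ≡ 0ℙ
  parity[2m]≡0ℙ m = *-homo-* 2 m

  parity-split : ∀ i j → parity (i +ℕ j) ≡ 1ℙ → parity i ≡ 1ℙ ⊎ parity j ≡ 1ℙ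
  parity-split i j odd with parity i | +-homo-+ i j
  ... | 0ℙ | i+j≡j = inj₂ (≡.trans (≡.sym i+j≡j) odd)
  ... | 1ℙ | _     = inj₁ ≡.refl

  2*m≢1 : ∀ m → 2 *ℕ m ≢ 1
  2*m≢1 m 2m≡1 with ℕ.m*n≡1⇒m≡1 2 m 2m≡1
  ... | ()

module SumsAndPowers {c ℓ} (F : CharZeroField c ℓ) where
  open CharZeroField F
  open FieldOps F
  open import Algebra.Definitions.RawMonoid +-rawMonoid using (_×_; sum)
  open import Algebra.Properties.Semiring.Exp semiring using (_^_)
  open import Algebra.Properties.Ring ring using (-‿distribˡ-*; -‿distribʳ-*; -‿involutive)
  open import Algebra.Properties.CommutativeSemigroup *-commutativeSemigroup using (interchange)
  open import Relation.Binary.Reasoning.Setoid setoid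

  sumTo-cong : ∀ n {f g : ℕ → Carrier} → (∀ i → i ≤ n → f i ≈ g i) → sumTo n f ≈ sumTo n g
  sumTo-cong zero    f≈g = f≈g 0 z≤n
  sumTo-cong (suc n) f≈g =
    +-cong (sumTo-cong n (λ i i≤n → f≈g i (ℕ.m≤n⇒m≤1+n i≤n))) (f≈g (suc n) ℕ.≤-refl)

  sumTo-zero : ∀ n {f : ℕ → Carrier} → (∀ i → i ≤ n → f i ≈ 0#) → sumTo n f ≈ 0#
  sumTo-zero zero    f≈0 = f≈0 0 z≤n
  sumTo-zero (suc n) f≈0 =
    trans (+-cong (sumTo-zero n (λ i i≤n → f≈0 i (ℕ.m≤n⇒m≤1+n i≤n))) (f≈0 (suc n) ℕ.≤-refl))
          (+-identityʳ 0#)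

  sumTo-single : ∀ n {k} (f : ℕ → Carrier) → k ≤ n → (∀ i → i ≤ n → i ≢ k → f i ≈ 0#) →
                 sumTo n f ≈ f k
  sumTo-single zero    f z≤n _ = refl
  sumTo-single (suc n) {k} f k≤1+n f≈0 with ℕ.m≤n⇒m<n∨m≡n k≤1+n
  ... | inj₁ k<1+n = begin
    sumTo n f + f (suc n)
      ≈⟨ +-cong (sumTo-single n f (s≤s⁻¹ k<1+n) (λ i i≤n → f≈0 i (ℕ.m≤n⇒m≤1+n i≤n)))
                (f≈0 (suc n) ℕ.≤-refl (ℕ.>⇒≢ k<1+n)) ⟩
    f k + 0#
      ≈⟨ +-identityʳ (f k) ⟩
    f k ∎
  ... | inj₂ ≡.refl = begin
    sumTo n f + f (suc n)
      ≈⟨ +-congʳ (sumTo-zero n (λ i i≤n → f≈0 i (ℕ.m≤n⇒m≤1+n i≤n) (ℕ.<⇒≢ (s≤s i≤n)))) ⟩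
    0# + f (suc n)
      ≈⟨ +-identityˡ (f (suc n)) ⟩
    f (suc n) ∎

  sumTo-distrib-+ : ∀ n (f g : ℕ → Carrier) →
                    sumTo n (λ i → f i + g i) ≈ sumTo n f + sumTo n g
  sumTo-distrib-+ zero    f g = refl
  sumTo-distrib-+ (suc n) f g = begin
    sumTo n (λ i → f i + g i) + (f (suc n) + g (suc n))
      ≈⟨ +-congʳ (sumTo-distrib-+ n f g) ⟩
    (sumTo n f + sumTo n g) + (f (suc n) + g (suc n))
      ≈⟨ +-assoc _ _ _ ⟩
    sumTo n f + (sumTo n g + (f (suc n) + g (suc n)))
      ≈⟨ +-congˡ (trans (+-comm _ _) (trans (+-assoc _ _ _) (+-congˡ (+-comm _ _)))) ⟩
    sumTo n f + (f (suc n) + (sumTo n g + g (suc n)))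
      ≈⟨ sym (+-assoc _ _ _) ⟩
    (sumTo n f + f (suc n)) + (sumTo n g + g (suc n)) ∎

  *-distribˡ-sumTo : ∀ n x (f : ℕ → Carrier) → x * sumTo n f ≈ sumTo n (λ i → x * f i)
  *-distribˡ-sumTo zero    x f = refl
  *-distribˡ-sumTo (suc n) x f = trans (distribˡ x _ _) (+-congʳ (*-distribˡ-sumTo n x f))

  *-distribʳ-sumTo : ∀ n x (f : ℕ → Carrier) → sumTo n f * x ≈ sumTo n (λ i → f i * x)
  *-distribʳ-sumTo zero    x f = refl
  *-distribʳ-sumTo (suc n) x f = trans (distribʳ x _ _) (+-congʳ (*-distribʳ-sumTo n x f))

  sumTo-head : ∀ n (f : ℕ → Carrier) → sumTo (suc n) f ≈ f 0 + sumTo n (f ∘ suc)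
  sumTo-head zero    f = refl
  sumTo-head (suc n) f = trans (+-congʳ (sumTo-head n f)) (+-assoc _ _ _)

  sumTo-reverse : ∀ n (f : ℕ → Carrier) → sumTo n f ≈ sumTo n (λ i → f (n ∸ i))
  sumTo-reverse zero    f = refl
  sumTo-reverse (suc n) f = begin
    sumTo n f + f (suc n)                       ≈⟨ +-comm _ _ ⟩
    f (suc n) + sumTo n f                       ≈⟨ +-congˡ (sumTo-reverse n f) ⟩
    f (suc n) + sumTo n (λ i → f (n ∸ i))       ≈⟨ sym (sumTo-head n (λ i → f (suc n ∸ i))) ⟩
    sumTo (suc n) (λ i → f (suc n ∸ i))         ∎

  sumTo-triangle : ∀ n (G : ℕ → ℕ → Carrier) →
                   sumTo n (λ k → sumTo k (λ i → G i k)) ≈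
                   sumTo n (λ i → sumTo (n ∸ i) (λ j → G i (i +ℕ j)))
  sumTo-triangle zero    G = refl
  sumTo-triangle (suc n) G = begin
    sumTo n (λ k → sumTo k (λ i → G i k)) + (sumTo n (λ i → G i (suc n)) + G (suc n) (suc n))
      ≈⟨ +-congʳ (sumTo-triangle n G) ⟩
    sumTo n row + (sumTo n (λ i → G i (suc n)) + G (suc n) (suc n))
      ≈⟨ sym (+-assoc _ _ _) ⟩
    (sumTo n row + sumTo n (λ i → G i (suc n))) + G (suc n) (suc n)
      ≈⟨ +-congʳ (sym (sumTo-distrib-+ n row (λ i → G i (suc n)))) ⟩
    sumTo n (λ i → row i + G i (suc n)) + G (suc n) (suc n)
      ≈⟨ +-cong (sumTo-cong n extend-row) last-row ⟩
    sumTo n (λ i → sumTo (suc n ∸ i) (λ j → G i (i +ℕ j))) + sumTo (n ∸ n) (λ j → G (suc n) (suc n +ℕ j)) ∎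
    where
    row : ℕ → Carrier
    row i = sumTo (n ∸ i) (λ j → G i (i +ℕ j))

    extend-row : ∀ i → i ≤ n → row i + G i (suc n) ≈ sumTo (suc n ∸ i) (λ j → G i (i +ℕ j))
    extend-row i i≤n = begin
      row i + G i (suc n)
        ≈⟨ +-congˡ (reflexive (cong (G i) (≡.sym (≡.trans (ℕ.+-suc i (n ∸ i)) (cong suc (ℕ.m+[n∸m]≡n i≤n)))))) ⟩
      sumTo (suc (n ∸ i)) (λ j → G i (i +ℕ j))
        ≈⟨ reflexive (cong (λ m → sumTo m (λ j → G i (i +ℕ j))) (≡.sym (ℕ.+-∸-assoc 1 i≤n))) ⟩
      sumTo (suc n ∸ i) (λ j → G i (i +ℕ j)) ∎

    last-row : G (suc n) (suc n) ≈ sumTo (n ∸ n) (λ j → G (suc n) (suc n +ℕ j))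
    last-row = begin
      G (suc n) (suc n)
        ≈⟨ reflexive (cong (G (suc n)) (≡.sym (ℕ.+-identityʳ (suc n)))) ⟩
      sumTo 0 (λ j → G (suc n) (suc n +ℕ j))
        ≈⟨ reflexive (cong (λ m → sumTo m (λ j → G (suc n) (suc n +ℕ j))) (≡.sym (ℕ.n∸n≡0 n))) ⟩
      sumTo (n ∸ n) (λ j → G (suc n) (suc n +ℕ j)) ∎

  ι1*x≈x : ∀ x → ι 1 * x ≈ x
  ι1*x≈x x = trans (*-congʳ (+-identityʳ 1#)) (*-identityˡ x)

  ι-homo-+ : ∀ m n → ι (m +ℕ n) ≈ ι m + ι n
  ι-homo-+ zero    n = sym (+-identityˡ (ι n))
  ι-homo-+ (suc m) n = trans (+-congˡ (ι-homo-+ m n)) (sym (+-assoc 1# (ι m) (ι n)))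

  ι-homo-* : ∀ m n → ι (m *ℕ n) ≈ ι m * ι n
  ι-homo-* zero    n = sym (zeroˡ (ι n))
  ι-homo-* (suc m) n = begin
    ι (n +ℕ m *ℕ n)        ≈⟨ trans (ι-homo-+ n (m *ℕ n)) (+-congˡ (ι-homo-* m n)) ⟩
    ι n + ι m * ι n        ≈⟨ +-congʳ (sym (*-identityˡ (ι n))) ⟩
    1# * ι n + ι m * ι n   ≈⟨ sym (distribʳ (ι n) 1# (ι m)) ⟩
    (1# + ι m) * ι n       ∎

  pow-homo-* : ∀ x m n → pow x (m +ℕ n) ≈ pow x m * pow x n
  pow-homo-* x zero    n = sym (*-identityˡ _)
  pow-homo-* x (suc m) n = trans (*-congˡ (pow-homo-* x m n)) (sym (*-assoc _ _ _))

  pow-distrib-* : ∀ x y n → pow (x * y) n ≈ pow x n * pow y n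
  pow-distrib-* x y zero    = sym (*-identityˡ 1#)
  pow-distrib-* x y (suc n) = begin
    x * y * pow (x * y) n          ≈⟨ *-congˡ (pow-distrib-* x y n) ⟩
    x * y * (pow x n * pow y n)    ≈⟨ interchange x y (pow x n) (pow y n) ⟩
    x * pow x n * (y * pow y n)    ∎

  -x*-y≈x*y : ∀ x y → - x * - y ≈ x * y
  -x*-y≈x*y x y = begin
    - x * - y       ≈⟨ sym (-‿distribˡ-* x (- y)) ⟩
    - (x * - y)     ≈⟨ -‿cong (sym (-‿distribʳ-* x y)) ⟩
    - - (x * y)     ≈⟨ -‿involutive (x * y) ⟩
    x * y           ∎

  pow-congˡ : ∀ {x y} n → x ≈ y → pow x n ≈ pow y n
  pow-congˡ zero    x≈y = refl
  pow-congˡ (suc n) x≈y = *-cong x≈y (pow-congˡ n x≈y)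

  pow-1# : ∀ n → pow 1# n ≈ 1#
  pow-1# zero    = refl
  pow-1# (suc n) = trans (*-identityˡ _) (pow-1# n)

  pow-neg-even : ∀ x k → parity k ≡ 0ℙ → pow (- x) k ≈ pow x k
  pow-neg-even x zero          _    = refl
  pow-neg-even x (suc (suc k)) even = begin
    - x * (- x * pow (- x) k)   ≈⟨ sym (*-assoc _ _ _) ⟩
    - x * - x * pow (- x) k     ≈⟨ *-cong (-x*-y≈x*y x x) (pow-neg-even x k even) ⟩
    x * x * pow x k             ≈⟨ *-assoc _ _ _ ⟩
    x * (x * pow x k)           ∎

  pow-neg-odd : ∀ x k → parity k ≡ 1ℙ → pow (- x) k ≈ - pow x k
  pow-neg-odd x (suc zero)    _   = trans (*-identityʳ (- x)) (-‿cong (sym (*-identityʳ x)))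
  pow-neg-odd x (suc (suc k)) odd = begin
    - x * (- x * pow (- x) k)   ≈⟨ sym (*-assoc _ _ _) ⟩
    - x * - x * pow (- x) k     ≈⟨ *-cong (-x*-y≈x*y x x) (pow-neg-odd x k odd) ⟩
    x * x * - pow x k           ≈⟨ sym (-‿distribʳ-* _ _) ⟩
    - (x * x * pow x k)         ≈⟨ -‿cong (*-assoc _ _ _) ⟩
    - (x * (x * pow x k))       ∎

  *-cancelˡ-nonzero : ∀ {x a b} → ¬ (x ≈ 0#) → x * a ≈ x * b → a ≈ b
  *-cancelˡ-nonzero {x} {a} {b} x≉0 xa≈xb = begin
    a                    ≈⟨ sym (*-identityˡ a) ⟩
    1# * a               ≈⟨ *-congʳ (sym (trans (*-comm _ _) (inverse x x≉0))) ⟩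
    inv x x≉0 * x * a    ≈⟨ *-assoc _ _ _ ⟩
    inv x x≉0 * (x * a)  ≈⟨ *-congˡ xa≈xb ⟩
    inv x x≉0 * (x * b)  ≈⟨ sym (*-assoc _ _ _) ⟩
    inv x x≉0 * x * b    ≈⟨ *-congʳ (trans (*-comm _ _) (inverse x x≉0)) ⟩
    1# * b               ≈⟨ *-identityˡ b ⟩
    b                    ∎

  sumTo≈sum : ∀ n (f : ℕ → Carrier) → sumTo n f ≈ sum (λ (i : Fin (suc n)) → f (toℕ i))
  sumTo≈sum zero    f = sym (+-identityʳ (f 0))
  sumTo≈sum (suc n) f = trans (sumTo-head n f) (+-congˡ (sumTo≈sum n (f ∘ suc)))

  ι*≈× : ∀ n x → ι n * x ≈ n × x
  ι*≈× zero    x = zeroˡ x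
  ι*≈× (suc n) x = trans (distribʳ x 1# (ι n)) (+-cong (*-identityˡ x) (ι*≈× n x))

  pow≈^ : ∀ x n → pow x n ≈ x ^ n
  pow≈^ x zero    = refl
  pow≈^ x (suc n) = *-congˡ (pow≈^ x n)

module HurwitzSeries {c ℓ} (F : CharZeroField c ℓ) where
  open CharZeroField F
  open FieldOps F
  open SumsAndPowers F
  open BinomialCoefficients using (nC[i+j]*[i+j]Ci≡nCi*[n∸i]Cj)
  open Parity using (parity-split)
  open import Algebra.Properties.CommutativeSemigroup *-commutativeSemigroup
    using (xy∙z≈xz∙y)
  open import Algebra.Solver.Ring.NaturalCoefficients.Default commutativeSemiring
    using (solve; _:*_; _:=_)
  open import Relation.Binary.Reasoning.Setoid setoid
  import Algebra.Construct.Pointwise ℕ as Pointwise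
  open import Algebra.Properties.CommutativeSemiring.Binomial commutativeSemiring
    using (binomialExpansion) renaming (theorem to binomialTheorem)
  open import Algebra.Definitions.RawMonoid +-rawMonoid using (_×_)
  open import Algebra.Properties.Monoid.Mult +-monoid using (×-congʳ)
  open import Algebra.Properties.Semiring.Exp semiring using (_^_)

  Seq : Set c
  Seq = ℕ → Carrier

  infix  4 _≋_
  infixl 6 _⊕_
  infixl 7 _⋆_

  _≋_ : Seq → Seq → Set ℓ
  a ≋ b = ∀ n → a n ≈ b n

  _⊕_ : Seq → Seq → Seq
  (a ⊕ b) n = a n + b n

  ⊖_ : Seq → Seq
  (⊖ a) n = - a n

  _⋆_ : Seq → Seq → Seq
  (a ⋆ b) n = sumTo n (λ k → ι (n C k) * a k * b (n ∸ k))

  δ : ℕ → Seq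
  δ zero    zero    = 1#
  δ zero    (suc _) = 0#
  δ (suc k) zero    = 0#
  δ (suc k) (suc i) = δ k i

  δ-off : ∀ k i → i ≢ k → δ k i ≈ 0#
  δ-off zero    zero    i≢k = ⊥-elim (i≢k ≡.refl)
  δ-off zero    (suc i) _   = refl
  δ-off (suc k) zero    _   = refl
  δ-off (suc k) (suc i) i≢k = δ-off k i (i≢k ∘ cong suc)

  ⋆-cong : ∀ {a a′ b b′} → a ≋ a′ → b ≋ b′ → a ⋆ b ≋ a′ ⋆ b′
  ⋆-cong a≋a′ b≋b′ n = sumTo-cong n (λ k _ → *-cong (*-congˡ (a≋a′ k)) (b≋b′ (n ∸ k)))

  ⋆-comm : ∀ a b → a ⋆ b ≋ b ⋆ a
  ⋆-comm a b n = begin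
    sumTo n (λ k → ι (n C k) * a k * b (n ∸ k))
      ≈⟨ sumTo-reverse n _ ⟩
    sumTo n (λ k → ι (n C (n ∸ k)) * a (n ∸ k) * b (n ∸ (n ∸ k)))
      ≈⟨ sumTo-cong n (λ k k≤n →
           trans (*-cong (*-congʳ (reflexive (cong ι (≡.sym (nCk≡nC[n∸k] k≤n)))))
                         (reflexive (cong b (ℕ.m∸[m∸n]≡n k≤n))))
                 (xy∙z≈xz∙y _ _ _)) ⟩
    sumTo n (λ k → ι (n C k) * b k * a (n ∸ k)) ∎

  ⋆-assoc : ∀ a b d → (a ⋆ b) ⋆ d ≋ a ⋆ (b ⋆ d)
  ⋆-assoc a b d n = begin
    sumTo n (λ k → ι (n C k) * (a ⋆ b) k * d (n ∸ k))
      ≈⟨ sumTo-cong n (λ k _ → trans (*-congʳ (*-distribˡ-sumTo k _ _)) (*-distribʳ-sumTo k _ _)) ⟩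
    sumTo n (λ k → sumTo k (λ i → term i k))
      ≈⟨ sumTo-triangle n term ⟩
    sumTo n (λ i → sumTo (n ∸ i) (λ j → term i (i +ℕ j)))
      ≈⟨ sumTo-cong n (λ i i≤n → sumTo-cong (n ∸ i) (λ j j≤n∸i →
           regroup i j (ℕ.≤-trans (ℕ.+-monoʳ-≤ i j≤n∸i) (ℕ.≤-reflexive (ℕ.m+[n∸m]≡n i≤n))))) ⟩
    sumTo n (λ i → sumTo (n ∸ i) (λ j → ι (n C i) * a i * (ι ((n ∸ i) C j) * b j * d (n ∸ i ∸ j))))
      ≈⟨ sumTo-cong n (λ i _ → sym (*-distribˡ-sumTo (n ∸ i) _ _)) ⟩
    sumTo n (λ i → ι (n C i) * a i * (b ⋆ d) (n ∸ i)) ∎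
    where
    term : ℕ → ℕ → Carrier
    term i k = ι (n C k) * (ι (k C i) * a i * b (k ∸ i)) * d (n ∸ k)

    regroup : ∀ i j → i +ℕ j ≤ n →
              term i (i +ℕ j) ≈ ι (n C i) * a i * (ι ((n ∸ i) C j) * b j * d (n ∸ i ∸ j))
    regroup i j i+j≤n = begin
      ι (n C (i +ℕ j)) * (ι ((i +ℕ j) C i) * a i * b (i +ℕ j ∸ i)) * d (n ∸ (i +ℕ j))
        ≈⟨ *-cong (*-congˡ (*-congˡ (reflexive (cong b (ℕ.m+n∸m≡n i j)))))
                  (reflexive (cong d (≡.sym (ℕ.∸-+-assoc n i j)))) ⟩
      ι (n C (i +ℕ j)) * (ι ((i +ℕ j) C i) * a i * b j) * d (n ∸ i ∸ j)
        ≈⟨ solve 5 (λ x y p q r → x :* (y :* p :* q) :* r := (x :* y) :* (p :* (q :* r))) refl _ _ _ _ _ ⟩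
      (ι (n C (i +ℕ j)) * ι ((i +ℕ j) C i)) * (a i * (b j * d (n ∸ i ∸ j)))
        ≈⟨ *-congʳ coefficients ⟩
      (ι (n C i) * ι ((n ∸ i) C j)) * (a i * (b j * d (n ∸ i ∸ j)))
        ≈⟨ solve 5 (λ x y p q r → (x :* y) :* (p :* (q :* r)) := x :* p :* (y :* q :* r)) refl _ _ _ _ _ ⟩
      ι (n C i) * a i * (ι ((n ∸ i) C j) * b j * d (n ∸ i ∸ j)) ∎
      where
      coefficients : ι (n C (i +ℕ j)) * ι ((i +ℕ j) C i) ≈ ι (n C i) * ι ((n ∸ i) C j)
      coefficients = begin
        ι (n C (i +ℕ j)) * ι ((i +ℕ j) C i)      ≈⟨ sym (ι-homo-* (n C (i +ℕ j)) ((i +ℕ j) C i)) ⟩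
        ι ((n C (i +ℕ j)) *ℕ ((i +ℕ j) C i))     ≈⟨ reflexive (cong ι (nC[i+j]*[i+j]Ci≡nCi*[n∸i]Cj i j i+j≤n)) ⟩
        ι ((n C i) *ℕ ((n ∸ i) C j))             ≈⟨ ι-homo-* (n C i) ((n ∸ i) C j) ⟩
        ι (n C i) * ι ((n ∸ i) C j)              ∎

  ⋆-distribˡ-⊕ : ∀ a b d → a ⋆ (b ⊕ d) ≋ a ⋆ b ⊕ a ⋆ d
  ⋆-distribˡ-⊕ a b d n =
    trans (sumTo-cong n (λ k _ → distribˡ _ _ _)) (sumTo-distrib-+ n _ _)

  ⋆-distribʳ-⊕ : ∀ a b d → (b ⊕ d) ⋆ a ≋ b ⋆ a ⊕ d ⋆ a
  ⋆-distribʳ-⊕ a b d n =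
    trans (sumTo-cong n (λ k _ → trans (*-congʳ (distribˡ _ _ _)) (distribʳ _ _ _))) (sumTo-distrib-+ n _ _)

  ⋆-singleˡ : ∀ k {a} (b : Seq) → (∀ i → i ≢ k → a i ≈ 0#) →
              ∀ n → (a ⋆ b) (k +ℕ n) ≈ ι ((k +ℕ n) C k) * a k * b n
  ⋆-singleˡ k {a} b a≈0 n = begin
    (a ⋆ b) (k +ℕ n)
      ≈⟨ sumTo-single (k +ℕ n) _ (ℕ.m≤m+n k n) (λ i _ i≢k →
           trans (*-congʳ (trans (*-congˡ (a≈0 i i≢k)) (zeroʳ _))) (zeroˡ _)) ⟩
    ι ((k +ℕ n) C k) * a k * b (k +ℕ n ∸ k)
      ≈⟨ *-congˡ (reflexive (cong b (ℕ.m+n∸m≡n k n))) ⟩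
    ι ((k +ℕ n) C k) * a k * b n ∎

  ⋆-identityˡ : ∀ a → δ 0 ⋆ a ≋ a
  ⋆-identityˡ a n = begin
    (δ 0 ⋆ a) n          ≈⟨ ⋆-singleˡ 0 a (δ-off 0) n ⟩
    ι 1 * 1# * a n       ≈⟨ *-congʳ (*-identityʳ (ι 1)) ⟩
    ι 1 * a n            ≈⟨ ι1*x≈x (a n) ⟩
    a n                  ∎

  ⋆-single1ˡ : ∀ {a} b → (∀ i → i ≢ 1 → a i ≈ 0#) → ∀ n → (a ⋆ b) (suc n) ≈ ι (suc n) * a 1 * b n
  ⋆-single1ˡ b a≈0 n = trans (⋆-singleˡ 1 b a≈0 n) (*-congʳ (*-congʳ (reflexive (cong ι (nC1≡n (suc n))))))

  δ1-⋆ : ∀ a n → (δ 1 ⋆ a) (suc n) ≈ ι (suc n) * a n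
  δ1-⋆ a n = trans (⋆-single1ˡ a (δ-off 1) n) (*-congʳ (*-identityʳ _))

  δ1-⋆-zero : ∀ a → (δ 1 ⋆ a) 0 ≈ 0#
  δ1-⋆-zero a = trans (*-congʳ (zeroʳ (ι 1))) (zeroˡ (a 0))

  δ1-⋆-cancel : ∀ {a b} → δ 1 ⋆ a ≋ δ 1 ⋆ b → a ≋ b
  δ1-⋆-cancel {a} {b} δ1a≋δ1b n =
    *-cancelˡ-nonzero (charZero n) (trans (sym (δ1-⋆ a n)) (trans (δ1a≋δ1b (suc n)) (δ1-⋆ b n)))

  hurwitzRing : CommutativeRing c ℓ
  hurwitzRing = record
    { Carrier           = Seq
    ; _≈_               = _≋_
    ; _+_               = _⊕_
    ; _*_               = _⋆_
    ; -_                = ⊖_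
    ; 0#                = λ _ → 0#
    ; 1#                = δ 0
    ; isCommutativeRing = record
      { isRing = record
        { +-isAbelianGroup = Pointwise.isAbelianGroup +-isAbelianGroup
        ; *-cong           = ⋆-cong
        ; *-assoc          = ⋆-assoc
        ; *-identity       = ⋆-identityˡ , λ a n → trans (⋆-comm a (δ 0) n) (⋆-identityˡ a n)
        ; distrib          = ⋆-distribˡ-⊕ , ⋆-distribʳ-⊕
        }
      ; *-comm = ⋆-comm
      }
    }

  -- f(z) ↦ f(t z)
  dilate : Carrier → Seq → Seq
  dilate t a k = pow t k * a k

  dilate-⋆ : ∀ t a b → dilate t (a ⋆ b) ≋ dilate t a ⋆ dilate t b
  dilate-⋆ t a b n = begin
    pow t n * sumTo n (λ k → ι (n C k) * a k * b (n ∸ k))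
      ≈⟨ *-distribˡ-sumTo n _ _ ⟩
    sumTo n (λ k → pow t n * (ι (n C k) * a k * b (n ∸ k)))
      ≈⟨ sumTo-cong n (λ k k≤n → trans (*-congʳ (split k≤n))
           (solve 5 (λ p q x y z → p :* q :* (x :* y :* z) := x :* (p :* y) :* (q :* z)) refl _ _ _ _ _)) ⟩
    (dilate t a ⋆ dilate t b) n ∎
    where
    split : ∀ {k} → k ≤ n → pow t n ≈ pow t k * pow t (n ∸ k)
    split {k} k≤n = trans (reflexive (cong (pow t) (≡.sym (ℕ.m+[n∸m]≡n k≤n)))) (pow-homo-* t k (n ∸ k))

  dilate-cong : ∀ t {a b} → a ≋ b → dilate t a ≋ dilate t b
  dilate-cong t a≋b n = *-congˡ (a≋b n)

  dilate-⊕ : ∀ t a b → dilate t (a ⊕ b) ≋ dilate t a ⊕ dilate t b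
  dilate-⊕ t a b n = distribˡ _ _ _

  dilate-pow : ∀ t x → dilate t (pow x) ≋ pow (t * x)
  dilate-pow t x n = sym (pow-distrib-* t x n)

  dilate-δ0 : ∀ t → dilate t (δ 0) ≋ δ 0
  dilate-δ0 t zero    = *-identityʳ 1#
  dilate-δ0 t (suc n) = zeroʳ _

  pow-0# : pow 0# ≋ δ 0
  pow-0# zero    = refl
  pow-0# (suc n) = zeroˡ _

  pow-⋆-pow : ∀ x y → pow x ⋆ pow y ≋ pow (x + y)
  pow-⋆-pow x y n = begin
    sumTo n (λ k → ι (n C k) * pow x k * pow y (n ∸ k))
      ≈⟨ sumTo-cong n (λ k _ → trans (*-assoc _ _ _) (trans (ι*≈× (n C k) _)
           (×-congʳ (n C k) (*-cong (pow≈^ x k) (pow≈^ y (n ∸ k)))))) ⟩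
    sumTo n (λ k → (n C k) × (x ^ k * y ^ (n ∸ k)))
      ≈⟨ sumTo≈sum n _ ⟩
    binomialExpansion x y n
      ≈⟨ sym (binomialTheorem n x y) ⟩
    (x + y) ^ n
      ≈⟨ sym (pow≈^ (x + y) n) ⟩
    pow (x + y) n ∎

  pow-neg-⋆-pow : ∀ x → pow (- x) ⋆ pow x ≋ δ 0
  pow-neg-⋆-pow x n = trans (pow-⋆-pow (- x) x n) (trans (pow-congˡ n (-‿inverseˡ x)) (pow-0# n))

  Even : Seq → Set ℓ
  Even a = ∀ k → parity k ≡ 1ℙ → a k ≈ 0#

  ⋆-even : ∀ {a b} → Even a → Even b → Even (a ⋆ b)
  ⋆-even {a} {b} a-even b-even n odd = sumTo-zero n (λ k k≤n → vanish k (parity-split k (n ∸ k)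
    (≡.subst (λ m → parity m ≡ 1ℙ) (≡.sym (ℕ.m+[n∸m]≡n k≤n)) odd)))
    where
    vanish : ∀ k → parity k ≡ 1ℙ ⊎ parity (n ∸ k) ≡ 1ℙ → ι (n C k) * a k * b (n ∸ k) ≈ 0#
    vanish k (inj₁ k-odd)   = trans (*-congʳ (trans (*-congˡ (a-even k k-odd)) (zeroʳ _))) (zeroˡ _)
    vanish k (inj₂ n∸k-odd) = trans (*-congˡ (b-even (n ∸ k) n∸k-odd)) (zeroʳ _)

  dilate-even : ∀ t {a} → Even a → Even (dilate t a)
  dilate-even t a-even k odd = trans (*-congˡ (a-even k odd)) (zeroʳ _)

module BernoulliCoefficients {c ℓ} (F : CharZeroField c ℓ) where
  open CharZeroField F
  open FieldOps F
  open SumsAndPowers F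
  open HurwitzSeries F
  open BinomialCoefficients using ([1+n]Cn≡1+n)
  open import Algebra.Properties.Ring ring using (-‿distribʳ-*; -‿involutive; -0#≈0#; -1*x≈-x)
  open import Algebra.Properties.CommutativeSemigroup *-commutativeSemigroup using (x∙yz≈y∙xz)
  open import Relation.Binary.Reasoning.Setoid setoid

  length-bernRev : ∀ m → length (bernRev m) ≡ suc m
  length-bernRev zero    = ≡.refl
  length-bernRev (suc m) = cong suc (length-bernRev m)

  weighted-bernRev : ∀ N m → weighted N (bernRev m) ≈ sumTo m (λ j → ι (N C j) * bernoulli j)
  weighted-bernRev N zero    = +-identityʳ _
  weighted-bernRev N (suc m) = begin
    ι (N C length (bernRev m)) * bernoulli (suc m) + weighted N (bernRev m)
      ≈⟨ +-cong (*-congʳ (reflexive (cong (λ l → ι (N C l)) (length-bernRev m)))) (weighted-bernRev N m) ⟩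
    ι (N C suc m) * bernoulli (suc m) + sumTo m (λ j → ι (N C j) * bernoulli j)
      ≈⟨ +-comm _ _ ⟩
    sumTo (suc m) (λ j → ι (N C j) * bernoulli j) ∎

  bernoulli-recurrence : ∀ m → sumTo (suc m) (λ j → ι (suc (suc m) C j) * bernoulli j) ≈ 0#
  bernoulli-recurrence m = begin
    S + ι (suc (suc m) C suc m) * - (recipSuc (suc m) * W)
      ≈⟨ +-congˡ (*-congʳ (reflexive (cong ι ([1+n]Cn≡1+n (suc m))))) ⟩
    S + ι (suc (suc m)) * - (recipSuc (suc m) * W)
      ≈⟨ +-congˡ (sym (-‿distribʳ-* _ _)) ⟩
    S + - (ι (suc (suc m)) * (recipSuc (suc m) * W))
      ≈⟨ +-congˡ (-‿cong (trans (sym (*-assoc _ _ _)) (trans (*-congʳ (inverse _ _)) (*-identityˡ W)))) ⟩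
    S + - W
      ≈⟨ +-congˡ (-‿cong (weighted-bernRev (suc (suc m)) m)) ⟩
    S + - S
      ≈⟨ -‿inverseʳ S ⟩
    0# ∎
    where
    W S : Carrier
    W = weighted (suc (suc m)) (bernRev m)
    S = sumTo m (λ j → ι (suc (suc m) C j) * bernoulli j)

  bernoulli-⋆-pow1 : bernoulli ⋆ pow 1# ≋ bernoulli ⊕ δ 1
  bernoulli-⋆-pow1 n = trans (sumTo-cong n (λ k _ → trans (*-congˡ (pow-1# (n ∸ k))) (*-identityʳ _))) (go n)
    where
    go : ∀ n → sumTo n (λ k → ι (n C k) * bernoulli k) ≈ bernoulli n + δ 1 n
    go zero          = *-identityʳ _
    go (suc zero)    = trans (+-cong (ι1*x≈x 1#) (ι1*x≈x (bernoulli 1))) (+-comm 1# (bernoulli 1))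
    go (suc (suc m)) = begin
      sumTo (suc m) (λ k → ι (suc (suc m) C k) * bernoulli k) + ι (suc (suc m) C suc (suc m)) * bernoulli (suc (suc m))
        ≈⟨ +-cong (bernoulli-recurrence m) (*-congʳ (reflexive (cong ι (nCn≡1 (suc (suc m)))))) ⟩
      0# + (1# + 0#) * bernoulli (suc (suc m))
        ≈⟨ trans (+-identityˡ _) (ι1*x≈x _) ⟩
      bernoulli (suc (suc m))
        ≈⟨ sym (+-identityʳ _) ⟩
      bernoulli (suc (suc m)) + 0# ∎

  bernoulli-1 : bernoulli 1 ≈ - recipSuc 1
  bernoulli-1 = -‿cong (trans (*-congˡ (trans (+-identityʳ _) (ι1*x≈x 1#))) (*-identityʳ _))

  -- recipSuc k = 1/(k+1) are the coefficients of (e^z − 1)/z.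
  δ1-⋆-recipSuc : δ 1 ⋆ recipSuc ≋ pow 1# ⊕ ⊖ δ 0
  δ1-⋆-recipSuc zero    = trans (δ1-⋆-zero recipSuc) (sym (-‿inverseʳ 1#))
  δ1-⋆-recipSuc (suc n) = begin
    (δ 1 ⋆ recipSuc) (suc n)   ≈⟨ δ1-⋆ recipSuc n ⟩
    ι (suc n) * recipSuc n     ≈⟨ inverse (ι (suc n)) (charZero n) ⟩
    1#                         ≈⟨ sym (pow-1# (suc n)) ⟩
    pow 1# (suc n)             ≈⟨ sym (trans (+-congˡ -0#≈0#) (+-identityʳ _)) ⟩
    pow 1# (suc n) + - 0#      ∎

  δ1-⋆-dilate-recipSuc : δ 1 ⋆ dilate (- 1#) recipSuc ≋ δ 0 ⊕ ⊖ pow (- 1#)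
  δ1-⋆-dilate-recipSuc zero    = trans (δ1-⋆-zero (dilate (- 1#) recipSuc)) (sym (-‿inverseʳ 1#))
  δ1-⋆-dilate-recipSuc (suc n) = begin
    (δ 1 ⋆ dilate (- 1#) recipSuc) (suc n)  ≈⟨ δ1-⋆ (dilate (- 1#) recipSuc) n ⟩
    ι (suc n) * (pow (- 1#) n * recipSuc n) ≈⟨ x∙yz≈y∙xz _ _ _ ⟩
    pow (- 1#) n * (ι (suc n) * recipSuc n) ≈⟨ *-congˡ (inverse (ι (suc n)) (charZero n)) ⟩
    pow (- 1#) n * 1#                       ≈⟨ *-identityʳ _ ⟩
    pow (- 1#) n                            ≈⟨ sym (-‿involutive _) ⟩
    - - pow (- 1#) n                        ≈⟨ -‿cong (sym (-1*x≈-x _)) ⟩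
    - (- 1# * pow (- 1#) n)                 ≈⟨ sym (+-identityˡ _) ⟩
    0# + - pow (- 1#) (suc n)               ∎

module BernoulliSeries {c ℓ} (F : CharZeroField c ℓ) where
  open CharZeroField F using (_≈_; _*_; 1#; -_)
  open FieldOps F using (pow; bernoulli; recipSuc)
  open SumsAndPowers F using (pow-congˡ)
  open HurwitzSeries F
  open BernoulliCoefficients F
  private module H = CommutativeRing hurwitzRing
  open import Algebra.Properties.CommutativeSemigroup H.*-commutativeSemigroup using (x∙yz≈y∙xz; interchange)
  open import Algebra.Properties.Ring H.ring using (x[y-z]≈xy-xz)
  open import Algebra.Properties.AbelianGroup H.+-abelianGroup using (xyx⁻¹≈y)
  open import Relation.Binary.Reasoning.Setoid H.setoid

  bernoulli-⋆-recipSuc : bernoulli ⋆ recipSuc ≋ δ 0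
  bernoulli-⋆-recipSuc = δ1-⋆-cancel (begin
    δ 1 ⋆ (bernoulli ⋆ recipSuc)                ≈⟨ x∙yz≈y∙xz (δ 1) bernoulli recipSuc ⟩
    bernoulli ⋆ (δ 1 ⋆ recipSuc)                ≈⟨ H.*-congˡ δ1-⋆-recipSuc ⟩
    bernoulli ⋆ (pow 1# ⊕ ⊖ δ 0)                ≈⟨ x[y-z]≈xy-xz bernoulli (pow 1#) (δ 0) ⟩
    bernoulli ⋆ pow 1# ⊕ ⊖ (bernoulli ⋆ δ 0)    ≈⟨ H.+-cong bernoulli-⋆-pow1 (H.-‿cong (H.*-identityʳ bernoulli)) ⟩
    bernoulli ⊕ δ 1 ⊕ ⊖ bernoulli               ≈⟨ xyx⁻¹≈y bernoulli (δ 1) ⟩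
    δ 1                                         ≈⟨ H.*-identityʳ (δ 1) ⟨
    δ 1 ⋆ δ 0                                   ∎)

  pow1-⋆-dilate-recipSuc : pow 1# ⋆ dilate (- 1#) recipSuc ≋ recipSuc
  pow1-⋆-dilate-recipSuc = δ1-⋆-cancel (begin
    δ 1 ⋆ (pow 1# ⋆ dilate (- 1#) recipSuc)     ≈⟨ x∙yz≈y∙xz (δ 1) (pow 1#) (dilate (- 1#) recipSuc) ⟩
    pow 1# ⋆ (δ 1 ⋆ dilate (- 1#) recipSuc)     ≈⟨ H.*-congˡ δ1-⋆-dilate-recipSuc ⟩
    pow 1# ⋆ (δ 0 ⊕ ⊖ pow (- 1#))               ≈⟨ x[y-z]≈xy-xz (pow 1#) (δ 0) (pow (- 1#)) ⟩
    pow 1# ⋆ δ 0 ⊕ ⊖ (pow 1# ⋆ pow (- 1#))      ≈⟨ H.+-cong (H.*-identityʳ (pow 1#))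
                                                     (H.-‿cong (H.trans (H.*-comm (pow 1#) (pow (- 1#))) (pow-neg-⋆-pow 1#))) ⟩
    pow 1# ⊕ ⊖ δ 0                              ≈⟨ δ1-⋆-recipSuc ⟨
    δ 1 ⋆ recipSuc                              ∎)

  dilate-bernoulli : dilate (- 1#) bernoulli ≋ bernoulli ⊕ δ 1
  dilate-bernoulli = begin
    dB                                          ≈⟨ H.*-identityʳ dB ⟨
    dB ⋆ δ 0                                    ≈⟨ H.*-congˡ bernoulli-⋆-recipSuc ⟨
    dB ⋆ (bernoulli ⋆ recipSuc)                 ≈⟨ H.*-congˡ (H.*-congˡ pow1-⋆-dilate-recipSuc) ⟨
    dB ⋆ (bernoulli ⋆ (pow 1# ⋆ dh))            ≈⟨ H.*-congˡ (H.*-assoc bernoulli (pow 1#) dh) ⟨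
    dB ⋆ (bernoulli ⋆ pow 1# ⋆ dh)              ≈⟨ x∙yz≈y∙xz dB (bernoulli ⋆ pow 1#) dh ⟩
    bernoulli ⋆ pow 1# ⋆ (dB ⋆ dh)              ≈⟨ H.*-congˡ (dilate-⋆ (- 1#) bernoulli recipSuc) ⟨
    bernoulli ⋆ pow 1# ⋆ dilate (- 1#) (bernoulli ⋆ recipSuc)
                                                ≈⟨ H.*-congˡ (H.trans (dilate-cong (- 1#) bernoulli-⋆-recipSuc) (dilate-δ0 (- 1#))) ⟩
    bernoulli ⋆ pow 1# ⋆ δ 0                    ≈⟨ H.*-identityʳ (bernoulli ⋆ pow 1#) ⟩
    bernoulli ⋆ pow 1#                          ≈⟨ bernoulli-⋆-pow1 ⟩
    bernoulli ⊕ δ 1                             ∎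
    where
    dB dh : Seq
    dB = dilate (- 1#) bernoulli
    dh = dilate (- 1#) recipSuc

  dilate-bernoulliPoly-⋆-bernoulliPoly : ∀ t w y → t * w ≈ - y →
    dilate t (bernoulli ⋆ pow w) ⋆ (bernoulli ⋆ pow y) ≋ dilate t bernoulli ⋆ bernoulli
  dilate-bernoulliPoly-⋆-bernoulliPoly t w y tw≈-y = begin
    dilate t (bernoulli ⋆ pow w) ⋆ (bernoulli ⋆ pow y)
      ≈⟨ H.*-congʳ {bernoulli ⋆ pow y} (H.trans (dilate-⋆ t bernoulli (pow w)) (H.*-congˡ (dilate-pow t w))) ⟩
    dB ⋆ pow (t * w) ⋆ (bernoulli ⋆ pow y)
      ≈⟨ H.*-congʳ {bernoulli ⋆ pow y} (H.*-congˡ {dB} (λ n → pow-congˡ n tw≈-y)) ⟩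
    dB ⋆ pow (- y) ⋆ (bernoulli ⋆ pow y)
      ≈⟨ interchange dB (pow (- y)) bernoulli (pow y) ⟩
    dB ⋆ bernoulli ⋆ (pow (- y) ⋆ pow y)
      ≈⟨ H.*-congˡ (pow-neg-⋆-pow y) ⟩
    dB ⋆ bernoulli ⋆ δ 0
      ≈⟨ H.*-identityʳ (dB ⋆ bernoulli) ⟩
    dB ⋆ bernoulli ∎
    where
    dB : Seq
    dB = dilate t bernoulli

module BernoulliProducts {c ℓ} (F : CharZeroField c ℓ) where
  open CharZeroField F
  open FieldOps F
  open SumsAndPowers F
  open HurwitzSeries F
  open BernoulliCoefficients F using (bernoulli-1)
  open BernoulliSeries F using (dilate-bernoulli)
  open Parity using (parity[1+2m]≡1ℙ; parity[2m]≡0ℙ; 2*m≢1)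
  open import Algebra.Properties.Ring ring using (-1*x≈-x; -‿involutive; -‿+-comm)
  open import Algebra.Solver.Ring.NaturalCoefficients.Default commutativeSemiring
    using (solve; _:+_; _:*_; _:=_; con)
  open import Relation.Binary.Reasoning.Setoid setoid

  bernoulli-odd : ∀ k → parity k ≡ 1ℙ → bernoulli (2 +ℕ k) ≈ 0#
  bernoulli-odd k odd = *-cancelˡ-nonzero (charZero 1) (begin
    ι 2 * b          ≈⟨ solve 1 (λ b → (con 1 :+ (con 1 :+ con 0)) :* b := b :+ b) refl b ⟩
    b + b            ≈⟨ +-congʳ (sym -b≈b) ⟩
    - b + b          ≈⟨ -‿inverseˡ b ⟩
    0#               ≈⟨ sym (zeroʳ (ι 2)) ⟩
    ι 2 * 0#         ∎)
    where
    b : Carrier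
    b = bernoulli (2 +ℕ k)
    -b≈b : - b ≈ b
    -b≈b = begin
      - b                       ≈⟨ sym (-1*x≈-x b) ⟩
      - 1# * b                  ≈⟨ *-congʳ (sym (trans (pow-neg-odd 1# (2 +ℕ k) odd) (-‿cong (pow-1# (2 +ℕ k))))) ⟩
      pow (- 1#) (2 +ℕ k) * b   ≈⟨ dilate-bernoulli (2 +ℕ k) ⟩
      b + 0#                    ≈⟨ +-identityʳ b ⟩
      b                         ∎

  evenBernoulli : Seq
  evenBernoulli zero          = bernoulli 0
  evenBernoulli (suc zero)    = 0#
  evenBernoulli (suc (suc k)) = bernoulli (suc (suc k))

  linearBernoulli : Seq
  linearBernoulli k = bernoulli 1 * δ 1 k

  bernoulli-split : bernoulli ≋ evenBernoulli ⊕ linearBernoulli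
  bernoulli-split zero          = sym (trans (+-congˡ (zeroʳ _)) (+-identityʳ _))
  bernoulli-split (suc zero)    = sym (trans (+-identityˡ _) (*-identityʳ _))
  bernoulli-split (suc (suc k)) = sym (trans (+-congˡ (zeroʳ _)) (+-identityʳ _))

  evenBernoulli-even : Even evenBernoulli
  evenBernoulli-even zero          ()
  evenBernoulli-even (suc zero)    _   = refl
  evenBernoulli-even (suc (suc k)) odd = bernoulli-odd k odd

  evenBernoulli≈bernoulli : ∀ k → k ≢ 1 → evenBernoulli k ≈ bernoulli k
  evenBernoulli≈bernoulli zero          _   = refl
  evenBernoulli≈bernoulli (suc zero)    k≢1 = ⊥-elim (k≢1 ≡.refl)
  evenBernoulli≈bernoulli (suc (suc k)) _   = refl

  linearBernoulli-off : ∀ i → i ≢ 1 → linearBernoulli i ≈ 0#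
  linearBernoulli-off i i≢1 = trans (*-congˡ (δ-off 1 i i≢1)) (zeroʳ _)

  dilate-bernoulli-⋆-bernoulli : ∀ t m →
    (dilate t bernoulli ⋆ bernoulli) (suc (2 *ℕ m)) ≈
    ι (suc (2 *ℕ m)) * bernoulli 1 * bernoulli (2 *ℕ m) * (t + pow t (2 *ℕ m))
  dilate-bernoulli-⋆-bernoulli t m = begin
    (dilate t bernoulli ⋆ bernoulli) n
      ≈⟨ ⋆-cong (λ k → trans (dilate-cong t bernoulli-split k) (dilate-⊕ t E L k)) bernoulli-split n ⟩
    ((dE ⊕ dL) ⋆ (E ⊕ L)) n
      ≈⟨ trans (⋆-distribʳ-⊕ (E ⊕ L) dE dL n) (+-cong (⋆-distribˡ-⊕ dE E L n) (⋆-distribˡ-⊕ dL E L n)) ⟩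
    ((dE ⋆ E) n + (dE ⋆ L) n) + ((dL ⋆ E) n + (dL ⋆ L) n)
      ≈⟨ +-cong (+-cong dE⋆E (trans (⋆-comm dE L n) L⋆dE)) (+-cong dL⋆E dL⋆L) ⟩
    (0# + ι n * β₁ * (pow t (2 *ℕ m) * β)) + (ι n * (t * β₁) * β + 0#)
      ≈⟨ +-cong (+-identityˡ _) (+-identityʳ _) ⟩
    ι n * β₁ * (pow t (2 *ℕ m) * β) + ι n * (t * β₁) * β
      ≈⟨ solve 5 (λ N b₁ p b t → N :* b₁ :* (p :* b) :+ N :* (t :* b₁) :* b := N :* b₁ :* b :* (t :+ p))
               refl (ι n) β₁ (pow t (2 *ℕ m)) β t ⟩
    ι n * β₁ * β * (t + pow t (2 *ℕ m)) ∎
    where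
    n : ℕ
    n  = suc (2 *ℕ m)
    β₁ β : Carrier
    β₁ = bernoulli 1
    β  = bernoulli (2 *ℕ m)
    E L dE dL : Seq
    E  = evenBernoulli
    L  = linearBernoulli
    dE = dilate t E
    dL = dilate t L

    E[2m]≈β : E (2 *ℕ m) ≈ β
    E[2m]≈β = evenBernoulli≈bernoulli (2 *ℕ m) (2*m≢1 m)

    dL-off : ∀ i → i ≢ 1 → dL i ≈ 0#
    dL-off i i≢1 = trans (*-congˡ (linearBernoulli-off i i≢1)) (zeroʳ _)

    dE⋆E : (dE ⋆ E) n ≈ 0#
    dE⋆E = ⋆-even (dilate-even t evenBernoulli-even) evenBernoulli-even n (parity[1+2m]≡1ℙ m)

    L⋆dE : (L ⋆ dE) n ≈ ι n * β₁ * (pow t (2 *ℕ m) * β)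
    L⋆dE = trans (⋆-single1ˡ dE linearBernoulli-off (2 *ℕ m))
                 (*-cong (*-congˡ (*-identityʳ β₁)) (*-congˡ E[2m]≈β))

    dL⋆E : (dL ⋆ E) n ≈ ι n * (t * β₁) * β
    dL⋆E = trans (⋆-single1ˡ E dL-off (2 *ℕ m))
                 (*-cong (*-congˡ (*-cong (*-identityʳ t) (*-identityʳ β₁))) E[2m]≈β)

    dL⋆L : (dL ⋆ L) n ≈ 0#
    dL⋆L = trans (⋆-single1ˡ L dL-off (2 *ℕ m))
                 (trans (*-congˡ (linearBernoulli-off (2 *ℕ m) (2*m≢1 m))) (zeroʳ _))

  dilate-neg-bernoulli-⋆-bernoulli : ∀ r m →
    (dilate (- r) bernoulli ⋆ bernoulli) (suc (2 *ℕ m)) ≈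
    ι (suc (2 *ℕ m)) * recipSuc 1 * (r - pow r (2 *ℕ m)) * bernoulli (2 *ℕ m)
  dilate-neg-bernoulli-⋆-bernoulli r m = begin
    (dilate (- r) bernoulli ⋆ bernoulli) n
      ≈⟨ dilate-bernoulli-⋆-bernoulli (- r) m ⟩
    ι n * bernoulli 1 * β * (- r + pow (- r) (2 *ℕ m))
      ≈⟨ *-cong (*-congʳ (*-congˡ bernoulli-1)) (+-congˡ (pow-neg-even r (2 *ℕ m) (parity[2m]≡0ℙ m))) ⟩
    ι n * - ½ * β * (- r + p)
      ≈⟨ solve 4 (λ N h b x → N :* h :* b :* x := N :* (h :* x) :* b) refl (ι n) (- ½) β (- r + p) ⟩
    ι n * (- ½ * (- r + p)) * β
      ≈⟨ *-congʳ (*-congˡ (trans (*-congˡ -r+p≈-[r-p]) (-x*-y≈x*y ½ (r - p)))) ⟩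
    ι n * (½ * (r - p)) * β
      ≈⟨ *-congʳ (sym (*-assoc _ _ _)) ⟩
    ι n * ½ * (r - p) * β ∎
    where
    n : ℕ
    n = suc (2 *ℕ m)
    ½ p β : Carrier
    ½ = recipSuc 1
    p = pow r (2 *ℕ m)
    β = bernoulli (2 *ℕ m)
    -r+p≈-[r-p] : - r + p ≈ - (r - p)
    -r+p≈-[r-p] = trans (+-congˡ (sym (-‿involutive p))) (-‿+-comm r (- p))

proposition1 : ∀ {c ℓ} (F : CharZeroField c ℓ) →
    let open CharZeroField F
        open FieldOps F
    in ∀ (m : ℕ) (y w : Carrier) (w≢0 : ¬ (w ≈ 0#)) →
       let n = suc (2 *ℕ m)
           r = y * inv w w≢0
       in sumTo n (λ k → pow (- 1#) k * ι (n C k) * pow r k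
                          * bernoulliPoly (n ∸ k) y * bernoulliPoly k w)
          ≈ ι n * recipSuc 1 * (r - pow r (n ∸ 1)) * bernoulli (n ∸ 1)
proposition1 F m y w w≢0 = begin
  sumTo n (λ k → pow (- 1#) k * ι (n C k) * pow r k * bernoulliPoly (n ∸ k) y * bernoulliPoly k w)
    ≈⟨ sumTo-cong n (λ k _ → regroup k) ⟩
  (dilate (- r) (bernoulli ⋆ pow w) ⋆ (bernoulli ⋆ pow y)) n
    ≈⟨ dilate-bernoulliPoly-⋆-bernoulliPoly (- r) w y -r*w≈-y n ⟩
  (dilate (- r) bernoulli ⋆ bernoulli) n
    ≈⟨ dilate-neg-bernoulli-⋆-bernoulli r m ⟩
  ι n * recipSuc 1 * (r - pow r (n ∸ 1)) * bernoulli (n ∸ 1) ∎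
  where
  open CharZeroField F
  open FieldOps F
  open SumsAndPowers F using (sumTo-cong; pow-congˡ; pow-distrib-*)
  open HurwitzSeries F using (_⋆_; dilate)
  open BernoulliSeries F using (dilate-bernoulliPoly-⋆-bernoulliPoly)
  open BernoulliProducts F using (dilate-neg-bernoulli-⋆-bernoulli)
  open import Algebra.Properties.Ring ring using (-1*x≈-x; -‿distribˡ-*)
  open import Algebra.Solver.Ring.NaturalCoefficients.Default commutativeSemiring using (solve; _:*_; _:=_)
  open import Relation.Binary.Reasoning.Setoid setoid

  n : ℕ
  n = suc (2 *ℕ m)
  r : Carrier
  r = y * inv w w≢0

  -r*w≈-y : - r * w ≈ - y
  -r*w≈-y = trans (sym (-‿distribˡ-* r w)) (-‿cong (trans (*-assoc y _ w)
              (trans (*-congˡ (trans (*-comm _ w) (inverse w w≢0))) (*-identityʳ y))))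

  regroup : ∀ k → pow (- 1#) k * ι (n C k) * pow r k * bernoulliPoly (n ∸ k) y * bernoulliPoly k w ≈
                  ι (n C k) * (pow (- r) k * bernoulliPoly k w) * bernoulliPoly (n ∸ k) y
  regroup k = trans
    (solve 5 (λ s c p P Q → s :* c :* p :* P :* Q := c :* (s :* p :* Q) :* P) refl
       (pow (- 1#) k) (ι (n C k)) (pow r k) (bernoulliPoly (n ∸ k) y) (bernoulliPoly k w))
    (*-congʳ (*-congˡ (*-congʳ (sym (trans (pow-congˡ k (sym (-1*x≈-x r))) (pow-distrib-* (- 1#) r k))))))
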